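{- Consider the Expected Instance LP of a stochastic matching instance. Call two resources $v,v'$ interchangeable if for every type $t_j\in T$, $v\in\Gamma(t_j)\iff v'\in\Gamma(t_j)$. If the instance contains an equivalence class $C$ of interchangeable resources with $|C|=\ell$, then there exists an optimal solution $x^*$ of the Expected Instance LP such that $x^*_{ij}\le 1/\ell$ for every edge $(v_i,t_j)$ with $v_i\in C$.
   Context: Stochastic matching instance: finite resource set $V=\{v_i\}$, finite set of request types $T=\{t_1,\dots,t_m\}$ with probabilities $p_j$ and compatibility sets $\Gamma(t_j)\subseteq V$, and $n$ requests. Expected Instance LP: variables $x_{ij}\ge0$ for $v_i\in\Gamma(t_j)$; maximize $Z(x)=\sum_j np_j\sum_{v_i\in\Gamma(t_j)}x_{ij}$ subject to $\sum_{j:v_i\in\Gamma(t_j)}np_jx_{ij}\le1$ for all $v_i\in V$ and $\sum_{v_i\in\Gamma(t_j)}x_{ij}\le1$ for all $t_j\in T$.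
   Formalization: The probabilities $p_j$ are rational, and both the optimal solution and the feasible solutions it is compared against are taken over ℚ. -}

module Defs where

open import Data.Nat using (ℕ; zero; suc)
open import Data.Fin using (Fin; zero; suc)
open import Data.Bool using (Bool; true; false; if_then_else_)
open import Data.Integer using (+_)
open import Data.Rational using (ℚ; 0ℚ; 1ℚ; _+_; _*_; _≤_; _/_)
open import Data.Product using (_×_; Σ; ∃)
open import Data.Fin.Subset using (Subset; _∈_)
open import Function.Bundles using (_⇔_)
open import Relation.Binary.PropositionalEquality using (_≡_)

∑ : (k : ℕ) → (Fin k → ℚ) → ℚ
∑ zero f = 0ℚ
∑ (suc k) f = f zero + ∑ k (λ i → f (suc i))

-- Resources V = Fin r, types T = Fin m.
-- Γ j i ≡ true  means  v_i ∈ Γ(t_j).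
Compat : ℕ → ℕ → Set
Compat r m = Fin m → Fin r → Bool

-- A candidate LP solution; only entries x i j with Γ j i ≡ true are variables,
-- the others are ignored (they never enter objective, constraints or conclusion).
Sol : ℕ → ℕ → Set
Sol r m = Fin r → Fin m → ℚ

np : {m : ℕ} → ℕ → (Fin m → ℚ) → Fin m → ℚ
np n p j = (+ n / 1) * p j

edgeVal : {r m : ℕ} → Compat r m → Sol r m → Fin r → Fin m → ℚ
edgeVal Γ x i j = if Γ j i then x i j else 0ℚ

objective : (r m : ℕ) → Compat r m → (Fin m → ℚ) → ℕ → Sol r m → ℚ
objective r m Γ p n x = ∑ m (λ j → np n p j * ∑ r (λ i → edgeVal Γ x i j))

Feasible : (r m : ℕ) → Compat r m → (Fin m → ℚ) → ℕ → Sol r m → Set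
Feasible r m Γ p n x =
  (∀ i j → Γ j i ≡ true → 0ℚ ≤ x i j)
  × (∀ i → ∑ m (λ j → np n p j * edgeVal Γ x i j) ≤ 1ℚ)
  × (∀ j → ∑ r (λ i → edgeVal Γ x i j) ≤ 1ℚ)

Optimal : (r m : ℕ) → Compat r m → (Fin m → ℚ) → ℕ → Sol r m → Set
Optimal r m Γ p n x =
  Feasible r m Γ p n x
  × (∀ y → Feasible r m Γ p n y → objective r m Γ p n y ≤ objective r m Γ p n x)

Interchangeable : {r m : ℕ} → Compat r m → Fin r → Fin r → Set
Interchangeable {m = m} Γ v v' = (j : Fin m) → (Γ j v ≡ true) ⇔ (Γ j v' ≡ true)

IsEquivClass : {r m : ℕ} → Compat r m → Subset r → Set
IsEquivClass {r} Γ C = Σ (Fin r) (λ v₀ → (v : Fin r) → (v ∈ C) ⇔ Interchangeable Γ v v₀)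

-- The capped program, i.e. the Expected Instance LP plus x i j ≤ 1/ℓ for the resources
-- i ∈ C, is feasible and bounded, so it has an optimal solution x*; Fourier–Motzkin
-- elimination produces it constructively over ℚ. Given any feasible y, replace its rows
-- i ∈ C by their average, i.e. give each member of C the ℓ-th part of the load that C
-- carries towards every type. Interchangeability makes this respect the edge set; the
-- column sums, and with them the objective, are unchanged; each member of C now carries
-- the average of the loads of the class, which is at most 1; and every new entry is at
-- most 1/ℓ because a column sum is at most 1. So the averaged solution is admissible for
-- the capped program, and the value of y is at most that of x*.

module Submission where

open import Defs
open import Data.Nat as ℕ using (ℕ; NonZero; zero; suc)
open import Data.Fin using (Fin; zero; suc)
open import Data.Fin.Subset using (Subset; _∈_; ∣_∣)
open import Data.Bool using (Bool; true; false; if_then_else_)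
open import Data.Bool.Properties using (⇔→≡)
open import Data.Integer as ℤ using (+_)
import Data.Integer.Properties as ℤ
open import Data.Rational
  using (ℚ; 0ℚ; 1ℚ; _+_; _*_; -_; _-_; _≤_; _<_; _/_; _÷_; 1/_; _⊔_; toℚᵘ; Positive; positive; nonNegative)
import Data.Rational as ℚ using (NonZero)
open import Data.Rational.Properties
open import Data.Rational.Solver using (module +-*-Solver)
import Data.Rational.Unnormalised as ℚᵘ
import Data.Rational.Unnormalised.Properties as ℚᵘ
open import Algebra.Properties.Group +-0-group using (⁻¹-involutive)
open import Data.Vec as Vec using (Vec; []; _∷_; lookup)
open import Data.Vec.Properties using (tabulate∘lookup; []=⇒lookup; lookup⇒[]=)
open import Data.List as List using (List; []; _∷_; _++_)
open import Data.List.Relation.Unary.All as All using (All; []; _∷_)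
import Data.List.Relation.Unary.All.Properties as All
open import Data.List.Relation.Unary.Any using (Any; here; there)
open import Data.Product using (Σ; _×_; _,_; proj₁; proj₂)
open import Data.Sum using (_⊎_; inj₁; inj₂)
open import Data.Empty using (⊥; ⊥-elim)
open import Function using (_∘_)
open import Function.Bundles using (_⇔_; mk⇔; Equivalence)
open import Relation.Nullary using (yes; no)
open import Relation.Binary.Definitions using (tri<; tri≈; tri>)
open import Relation.Binary.PropositionalEquality
  using (_≡_; refl; sym; trans; cong; cong₂; subst; subst₂; module ≡-Reasoning)

open +-*-Solver
open Equivalence using (to; from)

p+q≤0⇔p≤-q : ∀ p q → p + q ≤ 0ℚ ⇔ p ≤ - q
p+q≤0⇔p≤-q p q = mk⇔ forth back
  where
  open ≤-Reasoning
  forth : p + q ≤ 0ℚ → p ≤ - q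
  forth p+q≤0 = begin
    p             ≡⟨ solve 2 (λ p q → p := p :+ q :+ :- q) refl p q ⟩
    p + q + - q   ≤⟨ +-monoˡ-≤ (- q) p+q≤0 ⟩
    0ℚ + - q      ≡⟨ +-identityˡ (- q) ⟩
    - q           ∎
  back : p ≤ - q → p + q ≤ 0ℚ
  back p≤-q = begin
    p + q    ≤⟨ +-monoˡ-≤ q p≤-q ⟩
    - q + q  ≡⟨ +-inverseˡ q ⟩
    0ℚ       ∎

p-q≤0⇔p≤q : ∀ p q → p - q ≤ 0ℚ ⇔ p ≤ q
p-q≤0⇔p≤q p q = mk⇔ (subst (p ≤_) (⁻¹-involutive q) ∘ to (p+q≤0⇔p≤-q p (- q)))
                    (from (p+q≤0⇔p≤-q p (- q)) ∘ subst (p ≤_) (sym (⁻¹-involutive q)))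

0<1 : 0ℚ < 1ℚ
0<1 = positive⁻¹ 1ℚ

-p≤q⇒-q≤p : ∀ {p q} → - p ≤ q → - q ≤ p
-p≤q⇒-q≤p {p} -p≤q = subst (_ ≤_) (⁻¹-involutive p) (neg-antimono-≤ -p≤q)

*-monoˡ-≤-≥0 : ∀ {r p q} → 0ℚ ≤ r → p ≤ q → r * p ≤ r * q
*-monoˡ-≤-≥0 {r} 0≤r = *-monoˡ-≤-nonNeg r {{nonNegative 0≤r}}

0≤p*q : ∀ {p q} → 0ℚ ≤ p → 0ℚ ≤ q → 0ℚ ≤ p * q
0≤p*q {p} {q} 0≤p 0≤q = subst (_≤ p * q) (*-zeroʳ p) (*-monoˡ-≤-≥0 0≤p 0≤q)

p*q≤0 : ∀ {p q} → 0ℚ ≤ p → q ≤ 0ℚ → p * q ≤ 0ℚ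
p*q≤0 {p} {q} 0≤p q≤0 = subst (p * q ≤_) (*-zeroʳ p) (*-monoˡ-≤-≥0 0≤p q≤0)

pos-root : ∀ {a} e → 0ℚ < a → Σ ℚ λ u → a * u ≡ - e
pos-root {a} e 0<a = (- e) ÷ a , a*[-e÷a]≡-e
  where
  instance
    a≢0 : ℚ.NonZero a
    a≢0 = pos⇒nonZero a {{positive 0<a}}
  open ≡-Reasoning
  a*[-e÷a]≡-e : a * ((- e) ÷ a) ≡ - e
  a*[-e÷a]≡-e = begin
    a * (- e * 1/ a)  ≡⟨ solve 3 (λ a x y → a :* (x :* y) := x :* (a :* y)) refl a (- e) (1/ a) ⟩
    - e * (a * 1/ a)  ≡⟨ cong (- e *_) (*-inverseʳ a) ⟩
    - e * 1ℚ          ≡⟨ *-identityʳ (- e) ⟩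
    - e               ∎

-- Inequalities in one variable

Holds : ℚ × ℚ → ℚ → Set
Holds (a , e) t = a * t + e ≤ 0ℚ

holds⇔≤ : ∀ {a} e → 0ℚ < a → Σ ℚ λ u → ∀ t → Holds (a , e) t ⇔ t ≤ u
holds⇔≤ {a} e 0<a = u , λ t → mk⇔ (forth t) (back t)
  where
  instance
    a-pos : Positive a
    a-pos = positive 0<a
  u : ℚ
  u = proj₁ (pos-root e 0<a)
  au≡-e : a * u ≡ - e
  au≡-e = proj₂ (pos-root e 0<a)
  forth : ∀ t → a * t + e ≤ 0ℚ → t ≤ u
  forth t h = *-cancelˡ-≤-pos a (subst (a * t ≤_) (sym au≡-e) (to (p+q≤0⇔p≤-q (a * t) e) h))
  back : ∀ t → t ≤ u → a * t + e ≤ 0ℚ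
  back t t≤u = from (p+q≤0⇔p≤-q (a * t) e) (subst (a * t ≤_) au≡-e (*-monoˡ-≤-≥0 (<⇒≤ 0<a) t≤u))

holds⇔≥ : ∀ {a} e → a < 0ℚ → Σ ℚ λ l → ∀ t → Holds (a , e) t ⇔ l ≤ t
holds⇔≥ {a} e a<0 = - u , λ t → mk⇔ (forth t) (back t)
  where
  u : ℚ
  u = proj₁ (holds⇔≤ e (neg-antimono-< a<0))
  hu : ∀ s → Holds (- a , e) s ⇔ s ≤ u
  hu = proj₂ (holds⇔≤ e (neg-antimono-< a<0))
  reflect : ∀ t → a * t + e ≡ - a * - t + e
  reflect t = cong (_+ e) (solve 2 (λ a t → a :* t := (:- a) :* (:- t)) refl a t)
  forth : ∀ t → a * t + e ≤ 0ℚ → - u ≤ t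
  forth t h = -p≤q⇒-q≤p (to (hu (- t)) (subst (_≤ 0ℚ) (reflect t) h))
  back : ∀ t → - u ≤ t → a * t + e ≤ 0ℚ
  back t -u≤t = subst (_≤ 0ℚ) (sym (reflect t)) (from (hu (- t)) (-p≤q⇒-q≤p -u≤t))

holds-upward : ∀ {c s t} → proj₁ c < 0ℚ → Holds c s → s ≤ t → Holds c t
holds-upward {a , e} {s} {t} a<0 hs s≤t = upward (holds⇔≥ e a<0)
  where
  upward : (Σ ℚ λ l → ∀ t → Holds (a , e) t ⇔ l ≤ t) → Holds (a , e) t
  upward (l , hl) = from (hl t) (≤-trans (to (hl s) hs) s≤t)

HoldsIfPos HoldsIfNeg : ℚ → ℚ × ℚ → Set
HoldsIfPos t c = 0ℚ < proj₁ c → Holds c t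
HoldsIfNeg t c = proj₁ c < 0ℚ → Holds c t

HoldsIfConstant : ℚ × ℚ → Set
HoldsIfConstant (a , e) = a ≡ 0ℚ → e ≤ 0ℚ

holds-by-sign : ∀ {c t} → HoldsIfPos t c → HoldsIfNeg t c → HoldsIfConstant c → Holds c t
holds-by-sign {a , e} {t} hp hn hz with <-cmp 0ℚ a
... | tri< 0<a _ _ = hp 0<a
... | tri> _ _ a<0 = hn a<0
... | tri≈ _ refl _ = subst (_≤ 0ℚ) (sym (trans (cong (_+ e) (*-zeroˡ t)) (+-identityˡ e))) (hz refl)

Sat₁ : List (ℚ × ℚ) → ℚ → Set
Sat₁ cs t = All (λ c → Holds c t) cs

sat₁-by-sign : ∀ {cs t} → All (HoldsIfPos t) cs → All (HoldsIfNeg t) cs → All HoldsIfConstant cs → Sat₁ cs t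
sat₁-by-sign [] [] [] = []
sat₁-by-sign (p ∷ ps) (n ∷ ns) (z ∷ zs) = holds-by-sign p n z ∷ sat₁-by-sign ps ns zs

UpperEnvelope : List (ℚ × ℚ) → Set
UpperEnvelope cs =
  (∀ t → All (HoldsIfPos t) cs)
  ⊎ Σ ℚ λ u → (∀ t → All (HoldsIfPos t) cs ⇔ t ≤ u)
            × Any (λ c → 0ℚ < proj₁ c × ∀ t → Holds c t → t ≤ u) cs

upperEnvelope : ∀ cs → UpperEnvelope cs
upperEnvelope [] = inj₁ (λ _ → [])
upperEnvelope ((a , e) ∷ cs) with 0ℚ <? a
... | no a≯0 = skip (upperEnvelope cs)
  where
  vacuous : ∀ {t} → HoldsIfPos t (a , e)
  vacuous a>0 = ⊥-elim (a≯0 a>0)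
  skip : UpperEnvelope cs → UpperEnvelope ((a , e) ∷ cs)
  skip (inj₁ all) = inj₁ (λ t → vacuous ∷ all t)
  skip (inj₂ (v , hv , att)) = inj₂ (v , (λ t → mk⇔ (to (hv t) ∘ All.tail) ((vacuous ∷_) ∘ from (hv t))) , there att)
... | yes a>0 = insert (holds⇔≤ e a>0) (upperEnvelope cs)
  where
  head : ∀ {t} → All (HoldsIfPos t) ((a , e) ∷ cs) → Holds (a , e) t
  head h = All.head h a>0
  insert : (Σ ℚ λ u → ∀ t → Holds (a , e) t ⇔ t ≤ u) → UpperEnvelope cs → UpperEnvelope ((a , e) ∷ cs)
  insert (u , hu) (inj₁ all) =
    inj₂ (u , (λ t → mk⇔ (to (hu t) ∘ head) (λ t≤u → (λ _ → from (hu t) t≤u) ∷ all t)) , here (a>0 , to ∘ hu))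
  insert (u , hu) (inj₂ (v , hv , att)) with ≤-total u v
  ... | inj₁ u≤v = inj₂ (u , (λ t → mk⇔ (to (hu t) ∘ head)
                                        (λ t≤u → (λ _ → from (hu t) t≤u) ∷ from (hv t) (≤-trans t≤u u≤v)))
                          , here (a>0 , to ∘ hu))
  ... | inj₂ v≤u = inj₂ (v , (λ t → mk⇔ (to (hv t) ∘ All.tail)
                                        (λ t≤v → (λ _ → from (hu t) (≤-trans t≤v v≤u)) ∷ from (hv t) t≤v))
                          , there att)

lowerEnvelope : ∀ cs → Σ ℚ λ l → ∀ t → l ≤ t → All (HoldsIfNeg t) cs
lowerEnvelope [] = 0ℚ , λ _ _ → []
lowerEnvelope ((a , e) ∷ cs) with a <? 0ℚ | lowerEnvelope cs
... | no a≮0 | l , hl = l , λ t l≤t → (λ a<0 → ⊥-elim (a≮0 a<0)) ∷ hl t l≤t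
... | yes a<0 | l , hl = l₀ ⊔ l , λ t l≤t →
  (λ _ → from (h₀ t) (p⊔q≤r⇒p≤r l₀ l l≤t)) ∷ hl t (p⊔q≤r⇒q≤r l₀ l l≤t)
  where
  l₀ : ℚ
  l₀ = proj₁ (holds⇔≥ e a<0)
  h₀ : ∀ t → Holds (a , e) t ⇔ l₀ ≤ t
  h₀ = proj₂ (holds⇔≥ e a<0)

Compatible : ℚ × ℚ → ℚ × ℚ → Set
Compatible c d = 0ℚ < proj₁ c → proj₁ d < 0ℚ → Σ ℚ λ s → Holds c s × Holds d s

GreatestOrUnbounded : (ℚ → Set) → ℚ → Set
GreatestOrUnbounded P t = (∀ s → P s → s ≤ t) ⊎ (∀ s → t ≤ s → P s)

GreatestOrUnbounded-resp-⇔ : ∀ {P Q : ℚ → Set} {t} → (∀ s → P s ⇔ Q s)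
                           → GreatestOrUnbounded Q t → GreatestOrUnbounded P t
GreatestOrUnbounded-resp-⇔ P⇔Q (inj₁ greatest) = inj₁ (λ s → greatest s ∘ to (P⇔Q s))
GreatestOrUnbounded-resp-⇔ P⇔Q (inj₂ unbounded) = inj₂ (λ s → from (P⇔Q s) ∘ unbounded s)

-- If some upper bound on t exists, the least one, u, is attained by a single constraint c;
-- every lower-bound constraint has a solution in common with c, which lies below u, so it
-- holds at u as well.
solve₁ : ∀ cs → All HoldsIfConstant cs → All (λ c → All (Compatible c) cs) cs
       → Σ ℚ λ t → Sat₁ cs t × GreatestOrUnbounded (Sat₁ cs) t
solve₁ cs zs compat with upperEnvelope cs
... | inj₁ all = l , sat l ≤-refl , inj₂ sat
  where
  l : ℚ
  l = proj₁ (lowerEnvelope cs)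
  sat : ∀ s → l ≤ s → Sat₁ cs s
  sat s l≤s = sat₁-by-sign (all s) (proj₂ (lowerEnvelope cs) s l≤s) zs
... | inj₂ (u , hu , att) = u , sat₁-by-sign (from (hu u) ≤-refl) negs zs , inj₁ greatest
  where
  negs : All (HoldsIfNeg u) cs
  negs = All.lookupWith upward compat att
    where
    upward : ∀ {c} → All (Compatible c) cs → 0ℚ < proj₁ c × (∀ s → Holds c s → s ≤ u)
           → All (HoldsIfNeg u) cs
    upward {c} compat-c (c>0 , c≤u) = All.map (λ compat-cd d<0 → above (compat-cd c>0 d<0) d<0) compat-c
      where
      above : ∀ {d} → Σ ℚ (λ s → Holds c s × Holds d s) → proj₁ d < 0ℚ → Holds d u
      above (s , hc , hd) d<0 = holds-upward d<0 hd (c≤u s hc)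
  greatest : ∀ s → Sat₁ cs s → s ≤ u
  greatest s hs = to (hu s) (All.map (λ h _ → h) hs)

-- Fourier–Motzkin elimination

Affine : ℕ → Set
Affine k = Vec ℚ k × ℚ

dot : ∀ {k} → Vec ℚ k → Vec ℚ k → ℚ
dot [] [] = 0ℚ
dot (a ∷ as) (x ∷ xs) = a * x + dot as xs

eval : ∀ {k} → Affine k → Vec ℚ k → ℚ
eval (a , c) x = dot a x + c

Sat : ∀ {k} → List (Affine k) → Vec ℚ k → Set
Sat S x = All (λ f → eval f x ≤ 0ℚ) S

restrict : ∀ {k} → Vec ℚ k → Affine (suc k) → ℚ × ℚ
restrict x (a ∷ as , c) = a , eval (as , c) x

eval-∷ : ∀ {k} (f : Affine (suc k)) t x → eval f (t ∷ x) ≡ proj₁ (restrict x f) * t + proj₂ (restrict x f)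
eval-∷ (a ∷ as , c) t x = +-assoc (a * t) (dot as x) c

holds-restrict : ∀ {k} (f : Affine (suc k)) t x → Holds (restrict x f) t ⇔ eval f (t ∷ x) ≤ 0ℚ
holds-restrict f t x = mk⇔ (subst (_≤ 0ℚ) (sym (eval-∷ f t x))) (subst (_≤ 0ℚ) (eval-∷ f t x))

sat⇔sat₁ : ∀ {k} (S : List (Affine (suc k))) t x → Sat S (t ∷ x) ⇔ Sat₁ (List.map (restrict x) S) t
sat⇔sat₁ S t x = mk⇔
  (λ h → All.map⁺ (All.map (λ {f} → from (holds-restrict f t x)) h))
  (λ h → All.map (λ {f} → to (holds-restrict f t x)) (All.map⁻ h))

linComb : ∀ {k} → ℚ → ℚ → Affine k → Affine k → Affine k
linComb p q (a , c) (b , d) = Vec.zipWith (λ u v → p * u + q * v) a b , p * c + q * d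

dot-linComb : ∀ {k} p q (a b x : Vec ℚ k) →
  dot (Vec.zipWith (λ u v → p * u + q * v) a b) x ≡ p * dot a x + q * dot b x
dot-linComb p q [] [] [] = solve 2 (λ p q → con 0ℚ := p :* con 0ℚ :+ q :* con 0ℚ) refl p q
dot-linComb p q (a ∷ as) (b ∷ bs) (x ∷ xs) = begin
  (p * a + q * b) * x + dot (Vec.zipWith _ as bs) xs ≡⟨ cong (_+_ ((p * a + q * b) * x)) (dot-linComb p q as bs xs) ⟩
  (p * a + q * b) * x + (p * dot as xs + q * dot bs xs)
    ≡⟨ solve 7 (λ p q a b x u v → (p :* a :+ q :* b) :* x :+ (p :* u :+ q :* v)
                                  := p :* (a :* x :+ u) :+ q :* (b :* x :+ v)) refl p q a b x (dot as xs) (dot bs xs) ⟩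
  p * (a * x + dot as xs) + q * (b * x + dot bs xs) ∎
  where open ≡-Reasoning

eval-linComb : ∀ {k} p q (f g : Affine k) x → eval (linComb p q f g) x ≡ p * eval f x + q * eval g x
eval-linComb p q (a , c) (b , d) x = begin
  dot (Vec.zipWith _ a b) x + (p * c + q * d)  ≡⟨ cong (_+ (p * c + q * d)) (dot-linComb p q a b x) ⟩
  p * dot a x + q * dot b x + (p * c + q * d)
    ≡⟨ solve 6 (λ p q u v c d → p :* u :+ q :* v :+ (p :* c :+ q :* d) := p :* (u :+ c) :+ q :* (v :+ d))
               refl p q (dot a x) (dot b x) c d ⟩
  p * (dot a x + c) + q * (dot b x + d) ∎
  where open ≡-Reasoning

trivial : ∀ {k} → Affine k
trivial = Vec.replicate _ 0ℚ , 0ℚ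

eval-trivial : ∀ {k} (x : Vec ℚ k) → eval trivial x ≡ 0ℚ
eval-trivial [] = refl
eval-trivial (x ∷ xs) = trans (+-assoc (0ℚ * x) _ 0ℚ)
  (trans (cong₂ _+_ (*-zeroˡ x) (eval-trivial xs)) (+-identityˡ 0ℚ))

-- Eliminating the first variable t: a constraint not involving t is kept, and every
-- pair of an upper bound on t (coefficient a > 0) and a lower bound (coefficient b < 0)
-- is combined with the multipliers - b and a, which cancel t.
constantPart : ∀ {k} → Affine (suc k) → Affine k
constantPart (a ∷ as , c) with a ≟ 0ℚ
... | yes _ = as , c
... | no _ = trivial

constantPart-sound : ∀ {k} (f : Affine (suc k)) t x → eval f (t ∷ x) ≤ 0ℚ → eval (constantPart f) x ≤ 0ℚ
constantPart-sound f@(a ∷ as , c) t x h with a ≟ 0ℚ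
... | yes refl = subst (_≤ 0ℚ) (trans (eval-∷ f t x) (trans (cong (_+ eval (as , c) x) (*-zeroˡ t)) (+-identityˡ _))) h
... | no _ = ≤-reflexive (eval-trivial x)

constantPart-complete : ∀ {k} (f : Affine (suc k)) x → eval (constantPart f) x ≤ 0ℚ → HoldsIfConstant (restrict x f)
constantPart-complete (a ∷ as , c) x h a≡0 with a ≟ 0ℚ
... | yes _ = h
... | no a≢0 = ⊥-elim (a≢0 a≡0)

combine : ∀ {k} → Affine (suc k) → Affine (suc k) → Affine k
combine (a ∷ as , c) (b ∷ bs , d) with 0ℚ <? a | b <? 0ℚ
... | yes _ | yes _ = linComb (- b) a (as , c) (bs , d)
... | yes _ | no _ = trivial
... | no _ | _ = trivial

combine-sound : ∀ {k} (f g : Affine (suc k)) t x → eval f (t ∷ x) ≤ 0ℚ → eval g (t ∷ x) ≤ 0ℚ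
              → eval (combine f g) x ≤ 0ℚ
combine-sound f@(a ∷ as , c) g@(b ∷ bs , d) t x hf hg with 0ℚ <? a | b <? 0ℚ
... | yes a>0 | yes b<0 = begin
  eval (linComb (- b) a (as , c) (bs , d)) x   ≡⟨ eval-linComb (- b) a (as , c) (bs , d) x ⟩
  - b * E₁ + a * E₂
    ≡⟨ solve 5 (λ a b t u v → (:- b) :* u :+ a :* v := (:- b) :* (a :* t :+ u) :+ a :* (b :* t :+ v)) refl a b t E₁ E₂ ⟩
  - b * (a * t + E₁) + a * (b * t + E₂)
    ≤⟨ +-mono-≤ (p*q≤0 (<⇒≤ (neg-antimono-< b<0)) (subst (_≤ 0ℚ) (eval-∷ f t x) hf))
                (p*q≤0 (<⇒≤ a>0) (subst (_≤ 0ℚ) (eval-∷ g t x) hg)) ⟩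
  0ℚ + 0ℚ ≡⟨ +-identityˡ 0ℚ ⟩
  0ℚ ∎
  where
  open ≤-Reasoning
  E₁ E₂ : ℚ
  E₁ = eval (as , c) x
  E₂ = eval (bs , d) x
... | yes _ | no _ = ≤-reflexive (eval-trivial x)
... | no _ | _ = ≤-reflexive (eval-trivial x)

combine-complete : ∀ {k} (f g : Affine (suc k)) x → eval (combine f g) x ≤ 0ℚ
                 → Compatible (restrict x f) (restrict x g)
combine-complete (a ∷ as , c) (b ∷ bs , d) x h with 0ℚ <? a | b <? 0ℚ
... | yes a>0 | yes _ = λ _ _ → s , hf , hg
  where
  instance
    a-pos : Positive a
    a-pos = positive a>0
  E₁ E₂ : ℚ
  E₁ = eval (as , c) x
  E₂ = eval (bs , d) x
  s : ℚ
  s = proj₁ (pos-root E₁ a>0)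
  as≡-E₁ : a * s ≡ - E₁
  as≡-E₁ = proj₂ (pos-root E₁ a>0)
  hf : a * s + E₁ ≤ 0ℚ
  hf = ≤-reflexive (trans (cong (_+ E₁) as≡-E₁) (+-inverseˡ E₁))
  hg : b * s + E₂ ≤ 0ℚ
  hg = *-cancelˡ-≤-pos a (begin
    a * (b * s + E₂)      ≡⟨ solve 4 (λ a b s v → a :* (b :* s :+ v) := b :* (a :* s) :+ a :* v) refl a b s E₂ ⟩
    b * (a * s) + a * E₂  ≡⟨ cong (λ z → b * z + a * E₂) as≡-E₁ ⟩
    b * - E₁ + a * E₂     ≡⟨ cong (_+ a * E₂) (sym (neg-distribʳ-* b E₁)) ⟩
    - (b * E₁) + a * E₂   ≡⟨ cong (_+ a * E₂) (neg-distribˡ-* b E₁) ⟩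
    - b * E₁ + a * E₂     ≡⟨ eval-linComb (- b) a (as , c) (bs , d) x ⟨
    eval (linComb (- b) a (as , c) (bs , d)) x ≤⟨ h ⟩
    0ℚ                    ≡⟨ *-zeroʳ a ⟨
    a * 0ℚ                ∎)
    where open ≤-Reasoning
... | yes _ | no b≮0 = λ _ b<0 → ⊥-elim (b≮0 b<0)
... | no a≯0 | _ = λ a>0 _ → ⊥-elim (a≯0 a>0)

eliminate : ∀ {k} → List (Affine (suc k)) → List (Affine k)
eliminate S = List.map constantPart S ++ List.concatMap (λ f → List.map (combine f) S) S

eliminate-sound : ∀ {k} (S : List (Affine (suc k))) t x → Sat S (t ∷ x) → Sat (eliminate S) x
eliminate-sound S t x h = All.++⁺
  (All.map⁺ (All.map (λ {f} → constantPart-sound f t x) h))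
  (All.concat⁺ (All.map⁺ (All.map (λ {f} hf → All.map⁺ (All.map (λ {g} → combine-sound f g t x hf) h)) h)))

eliminate-complete : ∀ {k} (S : List (Affine (suc k))) x → Sat (eliminate S) x
  → Σ ℚ λ t → Sat S (t ∷ x) × GreatestOrUnbounded (λ s → Sat S (s ∷ x)) t
eliminate-complete S x h = lift (solve₁ (List.map (restrict x) S) constants compatible)
  where
  constants : All HoldsIfConstant (List.map (restrict x) S)
  constants = All.map⁺ (All.map (λ {f} → constantPart-complete f x) (All.map⁻ (All.++⁻ˡ _ h)))
  pairs : All (λ f → All (λ g → eval (combine f g) x ≤ 0ℚ) S) S
  pairs = All.map All.map⁻ (All.map⁻ (All.concat⁻ (All.++⁻ʳ _ h)))
  compatible : All (λ c → All (Compatible c) (List.map (restrict x) S)) (List.map (restrict x) S)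
  compatible = All.map⁺ (All.map (λ {f} → All.map⁺ ∘ All.map (λ {g} → combine-complete f g x)) pairs)
  lift : (Σ ℚ λ t → Sat₁ (List.map (restrict x) S) t × GreatestOrUnbounded (Sat₁ (List.map (restrict x) S)) t)
       → Σ ℚ λ t → Sat S (t ∷ x) × GreatestOrUnbounded (λ s → Sat S (s ∷ x)) t
  lift (t , sat , extremal) =
    t , from (sat⇔sat₁ S t x) sat , GreatestOrUnbounded-resp-⇔ (λ s → sat⇔sat₁ S s x) extremal

eliminateAll : ∀ k {j} → List (Affine (k ℕ.+ j)) → List (Affine j)
eliminateAll zero S = S
eliminateAll (suc k) S = eliminateAll k (eliminate S)

eliminateAll-sound : ∀ k {j} (S : List (Affine (k ℕ.+ j))) x y → Sat S (x Vec.++ y) → Sat (eliminateAll k S) y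
eliminateAll-sound zero S [] y h = h
eliminateAll-sound (suc k) S (t ∷ x) y h = eliminateAll-sound k (eliminate S) x y (eliminate-sound S t (x Vec.++ y) h)

eliminateAll-complete : ∀ k {j} (S : List (Affine (k ℕ.+ j))) y → Sat (eliminateAll k S) y
                      → Σ (Vec ℚ k) λ x → Sat S (x Vec.++ y)
eliminateAll-complete zero S y h = [] , h
eliminateAll-complete (suc k) S y h with eliminateAll-complete k (eliminate S) y h
... | x , hx with eliminate-complete S (x Vec.++ y) hx
...   | t , ht , _ = t ∷ x , ht

dot-++ : ∀ {k l} (a x : Vec ℚ k) (b y : Vec ℚ l) → dot (a Vec.++ b) (x Vec.++ y) ≡ dot a x + dot b y
dot-++ [] [] b y = sym (+-identityˡ _)
dot-++ (a ∷ as) (x ∷ xs) b y = trans (cong (_+_ (a * x)) (dot-++ as xs b y)) (sym (+-assoc (a * x) _ _))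

dot-neg : ∀ {k} (a x : Vec ℚ k) → dot (Vec.map -_ a) x ≡ - dot a x
dot-neg [] [] = refl
dot-neg (a ∷ as) (x ∷ xs) =
  trans (cong₂ _+_ (sym (neg-distribˡ-* a x)) (dot-neg as xs)) (sym (neg-distrib-+ (a * x) (dot as xs)))

liftAffine : ∀ {k} → Affine k → Affine (k ℕ.+ 1)
liftAffine (a , d) = a Vec.++ 0ℚ ∷ [] , d

eval-liftAffine : ∀ {k} (f : Affine k) x z → eval (liftAffine f) (x Vec.++ z ∷ []) ≡ eval f x
eval-liftAffine (a , d) x z = cong (_+ d) (trans (dot-++ a x (0ℚ ∷ []) (z ∷ []))
  (trans (cong (_+_ (dot a x)) (trans (+-identityʳ (0ℚ * z)) (*-zeroˡ z))) (+-identityʳ (dot a x))))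

withObjective : ∀ {k} → List (Affine k) → Vec ℚ k → List (Affine (k ℕ.+ 1))
withObjective S c = (Vec.map -_ c Vec.++ 1ℚ ∷ [] , 0ℚ) ∷ List.map liftAffine S

sat-withObjective : ∀ {k} (S : List (Affine k)) c x z
                  → Sat (withObjective S c) (x Vec.++ z ∷ []) ⇔ (Sat S x × z ≤ dot c x)
sat-withObjective S c x z = mk⇔
  (λ { (h₀ ∷ h) → All.map (λ {f} → subst (_≤ 0ℚ) (eval-liftAffine f x z)) (All.map⁻ h)
                , to (p-q≤0⇔p≤q z (dot c x)) (subst (_≤ 0ℚ) objective-row h₀) })
  (λ (hS , z≤cx) → subst (_≤ 0ℚ) (sym objective-row) (from (p-q≤0⇔p≤q z (dot c x)) z≤cx)
                 ∷ All.map⁺ (All.map (λ {f} → subst (_≤ 0ℚ) (sym (eval-liftAffine f x z))) hS))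
  where
  objective-row : eval (Vec.map -_ c Vec.++ 1ℚ ∷ [] , 0ℚ) (x Vec.++ z ∷ []) ≡ z - dot c x
  objective-row = begin
    dot (Vec.map -_ c Vec.++ 1ℚ ∷ []) (x Vec.++ z ∷ []) + 0ℚ  ≡⟨ +-identityʳ _ ⟩
    dot (Vec.map -_ c Vec.++ 1ℚ ∷ []) (x Vec.++ z ∷ [])       ≡⟨ dot-++ (Vec.map -_ c) x (1ℚ ∷ []) (z ∷ []) ⟩
    dot (Vec.map -_ c) x + (1ℚ * z + 0ℚ)                       ≡⟨ cong₂ _+_ (dot-neg c x) (trans (+-identityʳ _) (*-identityˡ z)) ⟩
    - dot c x + z                                              ≡⟨ +-comm (- dot c x) z ⟩
    z - dot c x                                                ∎
    where open ≡-Reasoning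

-- The values z below the objective of some feasible point form the solution set of a
-- one-variable system; its greatest element is the optimum, and it cannot be unbounded.
lp-optimum : ∀ {k} (S : List (Affine k)) (c : Vec ℚ k) {B} x₀ → Sat S x₀ → (∀ x → Sat S x → dot c x ≤ B)
           → Σ (Vec ℚ k) λ x* → Sat S x* × ∀ x → Sat S x → dot c x ≤ dot c x*
lp-optimum {k} S c {B} x₀ sat₀ bounded =
  conclude (eliminate-complete values [] (eliminate-sound values (dot c x₀) [] (attained x₀ sat₀)))
  where
  values : List (Affine 1)
  values = eliminateAll k (withObjective S c)
  attained : ∀ x → Sat S x → Sat values (dot c x ∷ [])
  attained x hx = eliminateAll-sound k _ x _ (from (sat-withObjective S c x (dot c x)) (hx , ≤-refl))
  dominated : ∀ z → Sat values (z ∷ []) → Σ (Vec ℚ k) λ x → Sat S x × z ≤ dot c x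
  dominated z hz with eliminateAll-complete k _ (z ∷ []) hz
  ... | x , hx = x , to (sat-withObjective S c x z) hx
  unbounded-absurd : ∀ {t} → (∀ s → t ≤ s → Sat values (s ∷ [])) → ⊥
  unbounded-absurd {t} unbounded with dominated (t ⊔ (B + 1ℚ)) (unbounded _ (p≤p⊔q t (B + 1ℚ)))
  ... | x , sat-x , t⊔[B+1]≤cx = <-irrefl refl (begin-strict
    B + 1ℚ       ≤⟨ p≤q⊔p t (B + 1ℚ) ⟩
    t ⊔ (B + 1ℚ) ≤⟨ t⊔[B+1]≤cx ⟩
    dot c x      ≤⟨ bounded x sat-x ⟩
    B            ≡⟨ +-identityʳ B ⟨
    B + 0ℚ       <⟨ +-monoʳ-< B 0<1 ⟩
    B + 1ℚ       ∎)
    where open ≤-Reasoning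
  conclude : (Σ ℚ λ t → Sat values (t ∷ []) × GreatestOrUnbounded (λ s → Sat values (s ∷ [])) t)
           → Σ (Vec ℚ k) λ x* → Sat S x* × ∀ x → Sat S x → dot c x ≤ dot c x*
  conclude (t , sat , inj₁ greatest) with dominated t sat
  ... | x* , sat* , t≤cx* = x* , sat* , λ x hx → ≤-trans (greatest (dot c x) (attained x hx)) t≤cx*
  conclude (t , sat , inj₂ unbounded) = ⊥-elim (unbounded-absurd unbounded)

-- Finite sums and matrices

∑-cong : ∀ k {f g : Fin k → ℚ} → (∀ i → f i ≡ g i) → ∑ k f ≡ ∑ k g
∑-cong zero f≡g = refl
∑-cong (suc k) f≡g = cong₂ _+_ (f≡g zero) (∑-cong k (f≡g ∘ suc))

∑-zero : ∀ k → ∑ k (λ _ → 0ℚ) ≡ 0ℚ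
∑-zero zero = refl
∑-zero (suc k) = trans (cong (_+_ 0ℚ) (∑-zero k)) (+-identityˡ 0ℚ)

∑-distrib-+ : ∀ k (f g : Fin k → ℚ) → ∑ k (λ i → f i + g i) ≡ ∑ k f + ∑ k g
∑-distrib-+ zero f g = sym (+-identityˡ 0ℚ)
∑-distrib-+ (suc k) f g = trans (cong (_+_ (f zero + g zero)) (∑-distrib-+ k (f ∘ suc) (g ∘ suc)))
  (solve 4 (λ a b c d → a :+ b :+ (c :+ d) := a :+ c :+ (b :+ d)) refl (f zero) (g zero) (∑ k (f ∘ suc)) (∑ k (g ∘ suc)))

*-distribˡ-∑ : ∀ k c (f : Fin k → ℚ) → c * ∑ k f ≡ ∑ k (λ i → c * f i)
*-distribˡ-∑ zero c f = *-zeroʳ c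
*-distribˡ-∑ (suc k) c f = trans (*-distribˡ-+ c (f zero) _) (cong (_+_ (c * f zero)) (*-distribˡ-∑ k c (f ∘ suc)))

∑-comm : ∀ r m (f : Fin r → Fin m → ℚ) → ∑ r (λ i → ∑ m (f i)) ≡ ∑ m (λ j → ∑ r (λ i → f i j))
∑-comm zero m f = sym (∑-zero m)
∑-comm (suc r) m f = trans (cong (_+_ (∑ m (f zero))) (∑-comm r m (f ∘ suc)))
  (sym (∑-distrib-+ m (f zero) (λ j → ∑ r (λ i → f (suc i) j))))

∑-mono-≤ : ∀ k {f g : Fin k → ℚ} → (∀ i → f i ≤ g i) → ∑ k f ≤ ∑ k g
∑-mono-≤ zero f≤g = ≤-refl
∑-mono-≤ (suc k) f≤g = +-mono-≤ (f≤g zero) (∑-mono-≤ k (f≤g ∘ suc))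

∑-≥0 : ∀ k {f : Fin k → ℚ} → (∀ i → 0ℚ ≤ f i) → 0ℚ ≤ ∑ k f
∑-≥0 k {f} 0≤f = subst (_≤ ∑ k f) (∑-zero k) (∑-mono-≤ k 0≤f)

δ : ∀ {k} → Fin k → Fin k → ℚ
δ zero zero = 1ℚ
δ zero (suc _) = 0ℚ
δ (suc _) zero = 0ℚ
δ (suc i) (suc i′) = δ i i′

∑-δ : ∀ k (i : Fin k) (f : Fin k → ℚ) → ∑ k (λ i′ → δ i i′ * f i′) ≡ f i
∑-δ (suc k) zero f = begin
  1ℚ * f zero + ∑ k (λ i′ → 0ℚ * f (suc i′)) ≡⟨ cong₂ _+_ (*-identityˡ (f zero)) (∑-cong k (λ i′ → *-zeroˡ (f (suc i′)))) ⟩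
  f zero + ∑ k (λ _ → 0ℚ)                     ≡⟨ cong (_+_ (f zero)) (∑-zero k) ⟩
  f zero + 0ℚ                                 ≡⟨ +-identityʳ (f zero) ⟩
  f zero                                      ∎
  where open ≡-Reasoning
∑-δ (suc k) (suc i) f =
  trans (cong (_+ ∑ k (λ i′ → δ i i′ * f (suc i′))) (*-zeroˡ (f zero))) (trans (+-identityˡ _) (∑-δ k i (f ∘ suc)))

⟪_,_⟫ : ∀ {r m} → Sol r m → Sol r m → ℚ
⟪_,_⟫ {r} {m} A x = ∑ r (λ i → ∑ m (λ j → A i j * x i j))

module _ {r m : ℕ} where

  rowMatrix : Fin r → (Fin m → ℚ) → Sol r m
  rowMatrix i B i′ j′ = δ i i′ * B j′

  colMatrix : Fin m → (Fin r → ℚ) → Sol r m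
  colMatrix j B i′ j′ = δ j j′ * B i′

  unitMatrix : Fin r → Fin m → ℚ → Sol r m
  unitMatrix i j k = rowMatrix i (λ j′ → δ j j′ * k)

  ⟪rowMatrix⟫ : ∀ i B x → ⟪ rowMatrix i B , x ⟫ ≡ ∑ m (λ j → B j * x i j)
  ⟪rowMatrix⟫ i B x = trans
    (∑-cong r (λ i′ → trans (∑-cong m (λ j′ → *-assoc (δ i i′) (B j′) (x i′ j′)))
                            (sym (*-distribˡ-∑ m (δ i i′) (λ j′ → B j′ * x i′ j′)))))
    (∑-δ r i (λ i′ → ∑ m (λ j′ → B j′ * x i′ j′)))

  ⟪colMatrix⟫ : ∀ j B x → ⟪ colMatrix j B , x ⟫ ≡ ∑ r (λ i → B i * x i j)
  ⟪colMatrix⟫ j B x = ∑-cong r (λ i′ →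
    trans (∑-cong m (λ j′ → *-assoc (δ j j′) (B i′) (x i′ j′))) (∑-δ m j (λ j′ → B i′ * x i′ j′)))

  ⟪unitMatrix⟫ : ∀ i j k x → ⟪ unitMatrix i j k , x ⟫ ≡ k * x i j
  ⟪unitMatrix⟫ i j k x = trans (⟪rowMatrix⟫ i (λ j′ → δ j j′ * k) x)
    (trans (∑-cong m (λ j′ → *-assoc (δ j j′) k (x i j′))) (∑-δ m j (λ j′ → k * x i j′)))

flatten : ∀ {r m} → Sol r m → Vec ℚ (r ℕ.* m)
flatten {zero} x = []
flatten {suc r} x = Vec.tabulate (x zero) Vec.++ flatten (x ∘ suc)

dot-tabulate : ∀ m (f g : Fin m → ℚ) → dot (Vec.tabulate f) (Vec.tabulate g) ≡ ∑ m (λ j → f j * g j)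
dot-tabulate zero f g = refl
dot-tabulate (suc m) f g = cong (_+_ (f zero * g zero)) (dot-tabulate m (f ∘ suc) (g ∘ suc))

dot-flatten : ∀ r m (A x : Sol r m) → dot (flatten A) (flatten x) ≡ ⟪ A , x ⟫
dot-flatten zero m A x = refl
dot-flatten (suc r) m A x = trans (dot-++ (Vec.tabulate (A zero)) (Vec.tabulate (x zero)) _ _)
  (cong₂ _+_ (dot-tabulate m (A zero) (x zero)) (dot-flatten r m (A ∘ suc) (x ∘ suc)))

flatten-surjective : ∀ r m (v : Vec ℚ (r ℕ.* m)) → Σ (Sol r m) λ x → flatten x ≡ v
flatten-surjective zero m [] = (λ ()) , refl
flatten-surjective (suc r) m v with Vec.splitAt m v
... | row , rest , v≡row++rest with flatten-surjective r m rest
...   | x , flatten-x≡rest = unflattened , trans (cong₂ Vec._++_ (tabulate∘lookup row) flatten-x≡rest) (sym v≡row++rest)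
  where
  unflattened : Sol (suc r) m
  unflattened zero = Vec.lookup row
  unflattened (suc i) = x i

AffineOn : ℕ → ℕ → Set
AffineOn r m = Sol r m × ℚ

evalOn : ∀ {r m} → AffineOn r m → Sol r m → ℚ
evalOn (A , c) x = ⟪ A , x ⟫ + c

SatOn : ∀ {r m} → List (AffineOn r m) → Sol r m → Set
SatOn S x = All (λ F → evalOn F x ≤ 0ℚ) S

flattenAffine : ∀ {r m} → AffineOn r m → Affine (r ℕ.* m)
flattenAffine (A , c) = flatten A , c

sat-flatten : ∀ {r m} (S : List (AffineOn r m)) x → Sat (List.map flattenAffine S) (flatten x) ⇔ SatOn S x
sat-flatten {r} {m} S x = mk⇔
  (λ h → All.map (λ {F} → subst (_≤ 0ℚ) (eval-flatten F)) (All.map⁻ h))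
  (λ h → All.map⁺ (All.map (λ {F} → subst (_≤ 0ℚ) (sym (eval-flatten F))) h))
  where
  eval-flatten : ∀ F → eval (flattenAffine F) (flatten x) ≡ evalOn F x
  eval-flatten (A , c) = cong (_+ c) (dot-flatten r m A x)

matrix-lp-optimum : ∀ {r m} (S : List (AffineOn r m)) (A : Sol r m) {B} x₀ → SatOn S x₀
                  → (∀ x → SatOn S x → ⟪ A , x ⟫ ≤ B)
                  → Σ (Sol r m) λ x* → SatOn S x* × ∀ x → SatOn S x → ⟪ A , x ⟫ ≤ ⟪ A , x* ⟫
matrix-lp-optimum {r} {m} S A {B} x₀ sat₀ bounded =
  unflatten (lp-optimum S♭ (flatten A) (flatten x₀) (from (sat-flatten S x₀) sat₀) bounded♭)
  where
  S♭ : List (Affine (r ℕ.* m))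
  S♭ = List.map flattenAffine S
  bounded♭ : ∀ v → Sat S♭ v → dot (flatten A) v ≤ B
  bounded♭ v hv with flatten-surjective r m v
  ... | x , refl = subst (_≤ B) (sym (dot-flatten r m A x)) (bounded x (to (sat-flatten S x) hv))
  unflatten : (Σ (Vec ℚ (r ℕ.* m)) λ v* → Sat S♭ v* × ∀ v → Sat S♭ v → dot (flatten A) v ≤ dot (flatten A) v*)
            → Σ (Sol r m) λ x* → SatOn S x* × ∀ x → SatOn S x → ⟪ A , x ⟫ ≤ ⟪ A , x* ⟫
  unflatten (v* , sat* , optimal) with flatten-surjective r m v*
  ... | x* , refl = x* , to (sat-flatten S x*) sat* , λ x hx →
    subst₂ _≤_ (dot-flatten r m A x) (dot-flatten r m A x*) (optimal (flatten x) (from (sat-flatten S x) hx))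

grid : ∀ {r m} {A : Set} → (Fin r → Fin m → A) → List A
grid f = List.concat (List.tabulate (λ i → List.tabulate (f i)))

All-tabulate⇔ : ∀ {k} {A : Set} {P : A → Set} (f : Fin k → A) → All P (List.tabulate f) ⇔ (∀ i → P (f i))
All-tabulate⇔ f = mk⇔ All.tabulate⁻ All.tabulate⁺

All-grid⇔ : ∀ {r m} {A : Set} {P : A → Set} (f : Fin r → Fin m → A) → All P (grid f) ⇔ (∀ i j → P (f i j))
All-grid⇔ f = mk⇔ (λ h i → All.tabulate⁻ (All.tabulate⁻ (All.concat⁻ h) i))
                  (λ h → All.concat⁺ (All.tabulate⁺ (λ i → All.tabulate⁺ (h i))))

All-++⇔ : ∀ {A : Set} {P : A → Set} xs {ys} → All P (xs ++ ys) ⇔ (All P xs × All P ys)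
All-++⇔ xs = mk⇔ (All.++⁻ xs) (λ (hx , hy) → All.++⁺ hx hy)

ind : Bool → ℚ
ind true = 1ℚ
ind false = 0ℚ

ind-* : ∀ b y → ind b * y ≡ (if b then y else 0ℚ)
ind-* true y = *-identityˡ y
ind-* false y = *-zeroˡ y

ind-≥0 : ∀ b → 0ℚ ≤ ind b
ind-≥0 true = <⇒≤ 0<1
ind-≥0 false = ≤-refl

ind-*-≤ : ∀ b {y} → 0ℚ ≤ y → ind b * y ≤ y
ind-*-≤ true {y} _ = ≤-reflexive (*-identityˡ y)
ind-*-≤ false {y} 0≤y = subst (_≤ y) (sym (*-zeroˡ y)) 0≤y

if-≥0 : ∀ b {q} → (b ≡ true → 0ℚ ≤ q) → 0ℚ ≤ (if b then q else 0ℚ)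
if-≥0 true h = h refl
if-≥0 false _ = ≤-refl

if-≡0 : ∀ b {q} → (b ≡ true → q ≡ 0ℚ) → (if b then q else 0ℚ) ≡ 0ℚ
if-≡0 true h = h refl
if-≡0 false _ = refl

if-swap : ∀ g b {a q} → (g ≡ false → b ≡ true → a ≡ 0ℚ)
        → (if g then (if b then a else q) else 0ℚ) ≡ (if b then a else (if g then q else 0ℚ))
if-swap true b _ = refl
if-swap false true h = sym (h refl refl)
if-swap false false _ = refl

∑-override : ∀ {r} (C : Subset r) a (f : Fin r → ℚ) →
  ∑ r (λ i → if lookup C i then a else f i)
    ≡ ∑ r f + (∑ r (λ i → ind (lookup C i)) * a - ∑ r (λ i → ind (lookup C i) * f i))
∑-override [] a f = solve 1 (λ a → con 0ℚ := con 0ℚ :+ (con 0ℚ :* a :- con 0ℚ)) refl a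
∑-override {suc r} (true ∷ C) a f = trans (cong (_+_ a) (∑-override C a (f ∘ suc)))
  (solve 5 (λ a x F Z Y → a :+ (F :+ (Z :* a :- Y)) := x :+ F :+ ((con 1ℚ :+ Z) :* a :- (con 1ℚ :* x :+ Y))) refl
     a (f zero) (∑ r (f ∘ suc)) (∑ r (λ i → ind (lookup C i))) (∑ r (λ i → ind (lookup C i) * f (suc i))))
∑-override {suc r} (false ∷ C) a f = trans (cong (_+_ (f zero)) (∑-override C a (f ∘ suc)))
  (solve 5 (λ a x F Z Y → x :+ (F :+ (Z :* a :- Y)) := x :+ F :+ ((con 0ℚ :+ Z) :* a :- (con 0ℚ :* x :+ Y))) refl
     a (f zero) (∑ r (f ∘ suc)) (∑ r (λ i → ind (lookup C i))) (∑ r (λ i → ind (lookup C i) * f (suc i))))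

guarded⇔ : ∀ b q → (b ≡ true → q ≤ 0ℚ) ⇔ ind b * q ≤ 0ℚ
guarded⇔ true q = mk⇔ (λ h → subst (_≤ 0ℚ) (sym (*-identityˡ q)) (h refl)) (λ h _ → subst (_≤ 0ℚ) (*-identityˡ q) h)
guarded⇔ false q = mk⇔ (λ _ → ≤-reflexive (*-zeroˡ q)) (λ _ ())

guarded-≤⇔ : ∀ b p q → (b ≡ true → p ≤ q) ⇔ ind b * (p - q) ≤ 0ℚ
guarded-≤⇔ b p q = mk⇔ (to (guarded⇔ b (p - q)) ∘ (from (p-q≤0⇔p≤q p q) ∘_))
                       (λ h → to (p-q≤0⇔p≤q p q) ∘ from (guarded⇔ b (p - q)) h)

1+[k/1]≡[1+k]/1 : ∀ k → 1ℚ + (+ k) / 1 ≡ (+ suc k) / 1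
1+[k/1]≡[1+k]/1 k = toℚᵘ-injective (begin
  toℚᵘ (1ℚ + (+ k) / 1)            ≈⟨ toℚᵘ-homo-+ 1ℚ ((+ k) / 1) ⟩
  ℚᵘ.1ℚᵘ ℚᵘ.+ toℚᵘ ((+ k) / 1)      ≈⟨ ℚᵘ.+-congʳ ℚᵘ.1ℚᵘ (toℚᵘ-fromℚᵘ (ℚᵘ.mkℚᵘ (+ k) 0)) ⟩
  ℚᵘ.1ℚᵘ ℚᵘ.+ ℚᵘ.mkℚᵘ (+ k) 0       ≈⟨ ℚᵘ.*≡* (trans (ℤ.*-identityʳ _) (trans (cong (ℤ._+_ (+ 1)) (ℤ.*-identityʳ (+ k)))
                                                                     (sym (ℤ.*-identityʳ (+ suc k))))) ⟩
  ℚᵘ.mkℚᵘ (+ suc k) 0               ≈⟨ toℚᵘ-fromℚᵘ (ℚᵘ.mkℚᵘ (+ suc k) 0) ⟨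
  toℚᵘ ((+ suc k) / 1)              ∎)
  where open ℚᵘ.≃-Reasoning

[ℓ/1]*[1/ℓ]≡1 : ∀ ℓ .{{_ : ℕ.NonZero ℓ}} → ((+ ℓ) / 1) * ((+ 1) / ℓ) ≡ 1ℚ
[ℓ/1]*[1/ℓ]≡1 (suc d) = toℚᵘ-injective (begin
  toℚᵘ (((+ suc d) / 1) * ((+ 1) / suc d))           ≈⟨ toℚᵘ-homo-* ((+ suc d) / 1) ((+ 1) / suc d) ⟩
  toℚᵘ ((+ suc d) / 1) ℚᵘ.* toℚᵘ ((+ 1) / suc d)  ≈⟨ ℚᵘ.*-cong (toℚᵘ-fromℚᵘ (ℚᵘ.mkℚᵘ (+ suc d) 0)) (toℚᵘ-fromℚᵘ (ℚᵘ.mkℚᵘ (+ 1) d)) ⟩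
  ℚᵘ.mkℚᵘ (+ suc d) 0 ℚᵘ.* ℚᵘ.mkℚᵘ (+ 1) d         ≈⟨ ℚᵘ.*-inverseʳ (ℚᵘ.mkℚᵘ (+ suc d) 0) ⟩
  ℚᵘ.1ℚᵘ                                          ∎)
  where open ℚᵘ.≃-Reasoning

∑-ind-lookup : ∀ {r} (C : Subset r) → ∑ r (λ i → ind (lookup C i)) ≡ (+ ∣ C ∣) / 1
∑-ind-lookup [] = refl
∑-ind-lookup (true ∷ C) = trans (cong (_+_ 1ℚ) (∑-ind-lookup C)) (1+[k/1]≡[1+k]/1 ∣ C ∣)
∑-ind-lookup (false ∷ C) = trans (+-identityˡ _) (∑-ind-lookup C)

module ExpectedInstance {r m : ℕ} (Γ : Compat r m) (p : Fin m → ℚ) (n : ℕ) where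

  w : Fin m → ℚ
  w = np n p

  Capped : Subset r → ℚ → Sol r m → Set
  Capped C L x = ∀ i j → i ∈ C → x i j ≤ L

  nonnegConstraint : Fin r → Fin m → AffineOn r m
  nonnegConstraint i j = unitMatrix i j (- ind (Γ j i)) , 0ℚ

  resourceConstraint : Fin r → AffineOn r m
  resourceConstraint i = rowMatrix i (λ j → w j * ind (Γ j i)) , - 1ℚ

  typeConstraint : Fin m → AffineOn r m
  typeConstraint j = colMatrix j (λ i → ind (Γ j i)) , - 1ℚ

  capConstraint : Subset r → ℚ → Fin r → Fin m → AffineOn r m
  capConstraint C L i j = unitMatrix i j (ind (lookup C i)) , - (ind (lookup C i) * L)

  nonneg⇔ : ∀ x i j → evalOn (nonnegConstraint i j) x ≤ 0ℚ ⇔ (Γ j i ≡ true → 0ℚ ≤ x i j)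
  nonneg⇔ x i j = mk⇔ (from (guarded-≤⇔ (Γ j i) 0ℚ (x i j)) ∘ subst (_≤ 0ℚ) value)
                      (subst (_≤ 0ℚ) (sym value) ∘ to (guarded-≤⇔ (Γ j i) 0ℚ (x i j)))
    where
    value : evalOn (nonnegConstraint i j) x ≡ ind (Γ j i) * (0ℚ - x i j)
    value = trans (cong (_+ 0ℚ) (⟪unitMatrix⟫ i j (- ind (Γ j i)) x))
      (solve 2 (λ b y → (:- b) :* y :+ con 0ℚ := b :* (con 0ℚ :- y)) refl (ind (Γ j i)) (x i j))

  cap⇔ : ∀ C L x i j → evalOn (capConstraint C L i j) x ≤ 0ℚ ⇔ (i ∈ C → x i j ≤ L)
  cap⇔ C L x i j = mk⇔ (λ h i∈C → from (guarded-≤⇔ (lookup C i) (x i j) L) (subst (_≤ 0ℚ) value h) ([]=⇒lookup i∈C))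
                      (λ h → subst (_≤ 0ℚ) (sym value) (to (guarded-≤⇔ (lookup C i) (x i j) L) (h ∘ lookup⇒[]= i C)))
    where
    value : evalOn (capConstraint C L i j) x ≡ ind (lookup C i) * (x i j - L)
    value = trans (cong (_+ - (ind (lookup C i) * L)) (⟪unitMatrix⟫ i j (ind (lookup C i)) x))
      (solve 3 (λ b y L → b :* y :+ :- (b :* L) := b :* (y :- L)) refl (ind (lookup C i)) (x i j) L)

  resource⇔ : ∀ x i → evalOn (resourceConstraint i) x ≤ 0ℚ ⇔ ∑ m (λ j → w j * edgeVal Γ x i j) ≤ 1ℚ
  resource⇔ x i = subst (λ v → v - 1ℚ ≤ 0ℚ ⇔ load ≤ 1ℚ) (sym value) (p-q≤0⇔p≤q load 1ℚ)
    where
    load : ℚ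
    load = ∑ m (λ j → w j * edgeVal Γ x i j)
    value : ⟪ rowMatrix i (λ j → w j * ind (Γ j i)) , x ⟫ ≡ load
    value = trans (⟪rowMatrix⟫ i _ x)
      (∑-cong m (λ j → trans (*-assoc (w j) _ (x i j)) (cong (w j *_) (ind-* (Γ j i) (x i j)))))

  type⇔ : ∀ x j → evalOn (typeConstraint j) x ≤ 0ℚ ⇔ ∑ r (λ i → edgeVal Γ x i j) ≤ 1ℚ
  type⇔ x j = subst (λ v → v - 1ℚ ≤ 0ℚ ⇔ load ≤ 1ℚ) (sym value) (p-q≤0⇔p≤q load 1ℚ)
    where
    load : ℚ
    load = ∑ r (λ i → edgeVal Γ x i j)
    value : ⟪ colMatrix j (λ i → ind (Γ j i)) , x ⟫ ≡ load
    value = trans (⟪colMatrix⟫ j _ x) (∑-cong r (λ i → ind-* (Γ j i) (x i j)))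

  cappedSystem : Subset r → ℚ → List (AffineOn r m)
  cappedSystem C L = grid nonnegConstraint ++ List.tabulate resourceConstraint
                  ++ List.tabulate typeConstraint ++ grid (capConstraint C L)

  cappedSystem⇔ : ∀ C L x → SatOn (cappedSystem C L) x ⇔ (Feasible r m Γ p n x × Capped C L x)
  cappedSystem⇔ C L x = mk⇔ forth back
    where
    forth : SatOn (cappedSystem C L) x → Feasible r m Γ p n x × Capped C L x
    forth h with to (All-++⇔ (grid nonnegConstraint)) h
    ... | h₁ , h₂₃₄ with to (All-++⇔ (List.tabulate resourceConstraint)) h₂₃₄
    ... | h₂ , h₃₄ with to (All-++⇔ (List.tabulate typeConstraint)) h₃₄
    ... | h₃ , h₄ =
      ( (λ i j → to (nonneg⇔ x i j) (to (All-grid⇔ nonnegConstraint) h₁ i j))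
      , (λ i → to (resource⇔ x i) (to (All-tabulate⇔ resourceConstraint) h₂ i))
      , (λ j → to (type⇔ x j) (to (All-tabulate⇔ typeConstraint) h₃ j)) )
      , (λ i j → to (cap⇔ C L x i j) (to (All-grid⇔ (capConstraint C L)) h₄ i j))
    back : Feasible r m Γ p n x × Capped C L x → SatOn (cappedSystem C L) x
    back ((nonneg , resource , type) , capped) =
      from (All-++⇔ (grid nonnegConstraint))
        ( from (All-grid⇔ nonnegConstraint) (λ i j → from (nonneg⇔ x i j) (nonneg i j))
        , from (All-++⇔ (List.tabulate resourceConstraint))
          ( from (All-tabulate⇔ resourceConstraint) (λ i → from (resource⇔ x i) (resource i))
          , from (All-++⇔ (List.tabulate typeConstraint))
            ( from (All-tabulate⇔ typeConstraint) (λ j → from (type⇔ x j) (type j))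
            , from (All-grid⇔ (capConstraint C L)) (λ i j → from (cap⇔ C L x i j) (capped i j)))))

  objectiveMatrix : Sol r m
  objectiveMatrix i j = w j * ind (Γ j i)

  ⟪objectiveMatrix⟫ : ∀ x → ⟪ objectiveMatrix , x ⟫ ≡ objective r m Γ p n x
  ⟪objectiveMatrix⟫ x = begin
    ∑ r (λ i → ∑ m (λ j → w j * ind (Γ j i) * x i j))
      ≡⟨ ∑-cong r (λ i → ∑-cong m (λ j → trans (*-assoc (w j) _ (x i j)) (cong (w j *_) (ind-* (Γ j i) (x i j))))) ⟩
    ∑ r (λ i → ∑ m (λ j → w j * edgeVal Γ x i j))  ≡⟨ ∑-comm r m (λ i j → w j * edgeVal Γ x i j) ⟩
    ∑ m (λ j → ∑ r (λ i → w j * edgeVal Γ x i j))  ≡⟨ ∑-cong m (λ j → *-distribˡ-∑ r (w j) (λ i → edgeVal Γ x i j)) ⟨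
    objective r m Γ p n x                          ∎
    where open ≡-Reasoning

  zero-feasible : ∀ C {L} → 0ℚ ≤ L → Feasible r m Γ p n (λ _ _ → 0ℚ) × Capped C L (λ _ _ → 0ℚ)
  zero-feasible C 0≤L =
    ( (λ _ _ _ → ≤-refl)
    , (λ i → subst (_≤ 1ℚ) (sym (trans (∑-cong m (λ j → trans (cong (w j *_) (edgeVal-zero i j)) (*-zeroʳ (w j))))
                                       (∑-zero m)))
                   (<⇒≤ 0<1))
    , (λ j → subst (_≤ 1ℚ) (sym (trans (∑-cong r (λ i → edgeVal-zero i j)) (∑-zero r))) (<⇒≤ 0<1)) )
    , (λ _ _ _ → 0≤L)
    where
    edgeVal-zero : ∀ i j → edgeVal Γ (λ _ _ → 0ℚ) i j ≡ 0ℚ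
    edgeVal-zero i j = if-≡0 (Γ j i) (λ _ → refl)

  objective-≤-∑w : (∀ j → 0ℚ ≤ w j) → ∀ x → Feasible r m Γ p n x → objective r m Γ p n x ≤ ∑ m w
  objective-≤-∑w 0≤w x (_ , _ , type) =
    ∑-mono-≤ m (λ j → ≤-trans (*-monoˡ-≤-≥0 (0≤w j) (type j)) (≤-reflexive (*-identityʳ (w j))))

  IsCappedOptimum : Subset r → ℚ → Sol r m → Set
  IsCappedOptimum C L x* = (Feasible r m Γ p n x* × Capped C L x*)
    × ∀ y → Feasible r m Γ p n y → Capped C L y → objective r m Γ p n y ≤ objective r m Γ p n x*

  capped-optimum : ∀ C {L} → 0ℚ ≤ L → (∀ j → 0ℚ ≤ w j) → Σ (Sol r m) (IsCappedOptimum C L)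
  capped-optimum C {L} 0≤L 0≤w = translate
    (matrix-lp-optimum (cappedSystem C L) objectiveMatrix (λ _ _ → 0ℚ)
      (from (cappedSystem⇔ C L (λ _ _ → 0ℚ)) (zero-feasible C 0≤L)) bounded)
    where
    bounded : ∀ x → SatOn (cappedSystem C L) x → ⟪ objectiveMatrix , x ⟫ ≤ ∑ m w
    bounded x hx = subst (_≤ ∑ m w) (sym (⟪objectiveMatrix⟫ x))
                         (objective-≤-∑w 0≤w x (proj₁ (to (cappedSystem⇔ C L x) hx)))
    translate : (Σ (Sol r m) λ x* → SatOn (cappedSystem C L) x*
                  × ∀ x → SatOn (cappedSystem C L) x → ⟪ objectiveMatrix , x ⟫ ≤ ⟪ objectiveMatrix , x* ⟫)
              → Σ (Sol r m) (IsCappedOptimum C L)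
    translate (x* , sat* , optimal) = x* , to (cappedSystem⇔ C L x*) sat* , λ y feasible capped →
      subst₂ _≤_ (⟪objectiveMatrix⟫ y) (⟪objectiveMatrix⟫ x*) (optimal y (from (cappedSystem⇔ C L y) (feasible , capped)))

  module Averaging (C : Subset r) (L : ℚ) (0≤L : 0ℚ ≤ L)
                   (∑χ*L≡1 : ∑ r (λ i → ind (lookup C i)) * L ≡ 1ℚ)
                   (same-edges : ∀ {i k} → i ∈ C → k ∈ C → ∀ j → Γ j i ≡ Γ j k)
                   (y : Sol r m) (y-feasible : Feasible r m Γ p n y) where

    χ : Fin r → ℚ
    χ i = ind (lookup C i)

    classLoad : Fin m → ℚ
    classLoad j = ∑ r (λ k → χ k * edgeVal Γ y k j)

    average : Sol r m
    average i j = if lookup C i then classLoad j * L else y i j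

    nonneg : ∀ i j → Γ j i ≡ true → 0ℚ ≤ y i j
    nonneg = proj₁ y-feasible
    resource : ∀ i → ∑ m (λ j → w j * edgeVal Γ y i j) ≤ 1ℚ
    resource = proj₁ (proj₂ y-feasible)
    type : ∀ j → ∑ r (λ i → edgeVal Γ y i j) ≤ 1ℚ
    type = proj₂ (proj₂ y-feasible)

    edgeVal-≥0 : ∀ i j → 0ℚ ≤ edgeVal Γ y i j
    edgeVal-≥0 i j = if-≥0 (Γ j i) (nonneg i j)

    classLoad-≥0 : ∀ j → 0ℚ ≤ classLoad j
    classLoad-≥0 j = ∑-≥0 r (λ k → 0≤p*q (ind-≥0 (lookup C k)) (edgeVal-≥0 k j))

    classLoad-≤1 : ∀ j → classLoad j ≤ 1ℚ
    classLoad-≤1 j = ≤-trans (∑-mono-≤ r (λ k → ind-*-≤ (lookup C k) (edgeVal-≥0 k j))) (type j)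

    classLoad-off-edge : ∀ {i} j → i ∈ C → Γ j i ≡ false → classLoad j ≡ 0ℚ
    classLoad-off-edge {i} j i∈C off = trans (∑-cong r vanishes) (∑-zero r)
      where
      vanishes : ∀ k → χ k * edgeVal Γ y k j ≡ 0ℚ
      vanishes k = trans (ind-* (lookup C k) _) (if-≡0 (lookup C k) λ k∈C →
        if-≡0 (Γ j k) λ on → contradiction (trans (sym on) (same-edges (lookup⇒[]= k C k∈C) i∈C j)) off)
        where
        contradiction : ∀ {b} → true ≡ b → b ≡ false → y k j ≡ 0ℚ
        contradiction refl ()

    edgeVal-average : ∀ i j → edgeVal Γ average i j ≡ (if lookup C i then classLoad j * L else edgeVal Γ y i j)
    edgeVal-average i j = if-swap (Γ j i) (lookup C i) λ off i∈C →
      trans (cong (_* L) (classLoad-off-edge j (lookup⇒[]= i C i∈C) off)) (*-zeroˡ L)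

    column-average : ∀ j → ∑ r (λ i → edgeVal Γ average i j) ≡ ∑ r (λ i → edgeVal Γ y i j)
    column-average j = begin
      ∑ r (λ i → edgeVal Γ average i j)                  ≡⟨ ∑-cong r (λ i → edgeVal-average i j) ⟩
      ∑ r (λ i → if lookup C i then S * L else edgeVal Γ y i j)
                                                         ≡⟨ ∑-override C (S * L) (λ i → edgeVal Γ y i j) ⟩
      column + (∑ r χ * (S * L) - S)                     ≡⟨ cong (λ v → column + (v - S)) spread ⟩
      column + (S - S)                                   ≡⟨ cong (_+_ column) (+-inverseʳ S) ⟩
      column + 0ℚ                                        ≡⟨ +-identityʳ column ⟩
      column                                             ∎
      where
      open ≡-Reasoning
      S column : ℚ
      S = classLoad j
      column = ∑ r (λ i → edgeVal Γ y i j)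
      spread : ∑ r χ * (S * L) ≡ S
      spread = trans (solve 3 (λ c s l → c :* (s :* l) := s :* (c :* l)) refl (∑ r χ) S L)
                     (trans (cong (S *_) ∑χ*L≡1) (*-identityʳ S))

    objective-average : objective r m Γ p n average ≡ objective r m Γ p n y
    objective-average = ∑-cong m (λ j → cong (w j *_) (column-average j))

    class-resource : ∑ m (λ j → w j * (classLoad j * L)) ≤ 1ℚ
    class-resource = begin
      ∑ m (λ j → w j * (classLoad j * L))
        ≡⟨ ∑-cong m (λ j → solve 3 (λ w s l → w :* (s :* l) := l :* (w :* s)) refl (w j) (classLoad j) L) ⟩
      ∑ m (λ j → L * (w j * classLoad j))      ≡⟨ *-distribˡ-∑ m L (λ j → w j * classLoad j) ⟨
      L * ∑ m (λ j → w j * classLoad j)        ≡⟨ cong (L *_) regroup ⟩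
      L * ∑ r (λ k → χ k * ∑ m (λ j → w j * edgeVal Γ y k j))
        ≤⟨ *-monoˡ-≤-≥0 0≤L (∑-mono-≤ r (λ k → *-monoˡ-≤-≥0 (ind-≥0 (lookup C k)) (resource k))) ⟩
      L * ∑ r (λ k → χ k * 1ℚ)                 ≡⟨ cong (L *_) (∑-cong r (λ k → *-identityʳ (χ k))) ⟩
      L * ∑ r χ                                ≡⟨ *-comm L (∑ r χ) ⟩
      ∑ r χ * L                                ≡⟨ ∑χ*L≡1 ⟩
      1ℚ                                       ∎
      where
      open ≤-Reasoning
      regroup : ∑ m (λ j → w j * classLoad j) ≡ ∑ r (λ k → χ k * ∑ m (λ j → w j * edgeVal Γ y k j))
      regroup = trans (∑-cong m (λ j → *-distribˡ-∑ r (w j) (λ k → χ k * edgeVal Γ y k j)))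
        (trans (sym (∑-comm r m (λ k j → w j * (χ k * edgeVal Γ y k j))))
               (∑-cong r (λ k → trans (∑-cong m (λ j → solve 3 (λ w c e → w :* (c :* e) := c :* (w :* e)) refl
                                                                (w j) (χ k) (edgeVal Γ y k j)))
                                      (sym (*-distribˡ-∑ m (χ k) (λ j → w j * edgeVal Γ y k j))))))

    average-feasible : Feasible r m Γ p n average
    average-feasible = average-≥0 , average-resource , average-type
      where
      average-≥0 : ∀ i j → Γ j i ≡ true → 0ℚ ≤ average i j
      average-≥0 i j on = by-membership (lookup C i)
        where
        by-membership : ∀ b → 0ℚ ≤ (if b then classLoad j * L else y i j)
        by-membership true = 0≤p*q (classLoad-≥0 j) 0≤L
        by-membership false = nonneg i j on
      average-resource : ∀ i → ∑ m (λ j → w j * edgeVal Γ average i j) ≤ 1ℚ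
      average-resource i = subst (_≤ 1ℚ) (sym (∑-cong m (λ j → cong (w j *_) (edgeVal-average i j))))
                                 (by-membership (lookup C i))
        where
        by-membership : ∀ b → ∑ m (λ j → w j * (if b then classLoad j * L else edgeVal Γ y i j)) ≤ 1ℚ
        by-membership true = class-resource
        by-membership false = resource i
      average-type : ∀ j → ∑ r (λ i → edgeVal Γ average i j) ≤ 1ℚ
      average-type j = subst (_≤ 1ℚ) (sym (column-average j)) (type j)

    average-capped : Capped C L average
    average-capped i j i∈C = subst (λ b → (if b then classLoad j * L else y i j) ≤ L) (sym ([]=⇒lookup i∈C)) (begin
      classLoad j * L  ≡⟨ *-comm (classLoad j) L ⟩
      L * classLoad j  ≤⟨ *-monoˡ-≤-≥0 0≤L (classLoad-≤1 j) ⟩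
      L * 1ℚ           ≡⟨ *-identityʳ L ⟩
      L                ∎)
      where open ≤-Reasoning

mainTheorem3 : (r m : ℕ) (Γ : Compat r m) (p : Fin m → ℚ) (n : ℕ)
    → ((j : Fin m) → 0ℚ ≤ p j) → ∑ m p ≡ 1ℚ
    → (C : Subset r) → IsEquivClass Γ C
    → (ℓ : ℕ) → ∣ C ∣ ≡ ℓ → .{{_ : NonZero ℓ}}
    → Σ (Sol r m) (λ x → Optimal r m Γ p n x
    × ((i : Fin r) (j : Fin m) → i ∈ C → Γ j i ≡ true → x i j ≤ (+ 1) / ℓ))
mainTheorem3 r m Γ p n 0≤p _ C (v₀ , class) ℓ ∣C∣≡ℓ = conclude (capped-optimum C 0≤L 0≤w)
  where
  open ExpectedInstance Γ p n
  L : ℚ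
  L = (+ 1) / ℓ
  0≤L : 0ℚ ≤ L
  0≤L = nonNegative⁻¹ L {{normalize-nonNeg 1 ℓ}}
  0≤w : ∀ j → 0ℚ ≤ w j
  0≤w j = 0≤p*q (nonNegative⁻¹ ((+ n) / 1) {{normalize-nonNeg n 1}}) (0≤p j)
  ∑χ*L≡1 : ∑ r (λ i → ind (lookup C i)) * L ≡ 1ℚ
  ∑χ*L≡1 = trans (cong (_* L) (trans (∑-ind-lookup C) (cong (λ k → (+ k) / 1) ∣C∣≡ℓ))) ([ℓ/1]*[1/ℓ]≡1 ℓ)
  same-edges : ∀ {i k} → i ∈ C → k ∈ C → ∀ j → Γ j i ≡ Γ j k
  same-edges i∈C k∈C j = trans (⇔→≡ (to (class _) i∈C j)) (sym (⇔→≡ (to (class _) k∈C j)))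
  conclude : Σ (Sol r m) (IsCappedOptimum C L)
           → Σ (Sol r m) (λ x → Optimal r m Γ p n x × ((i : Fin r) (j : Fin m) → i ∈ C → Γ j i ≡ true → x i j ≤ L))
  conclude (x* , (feasible , capped) , capped-optimal) = x* , (feasible , optimal) , λ i j i∈C _ → capped i j i∈C
    where
    optimal : ∀ y → Feasible r m Γ p n y → objective r m Γ p n y ≤ objective r m Γ p n x*
    optimal y y-feasible = subst (_≤ objective r m Γ p n x*) objective-average
        (capped-optimal average average-feasible average-capped)
      where open Averaging C L 0≤L ∑χ*L≡1 same-edges y y-feasible
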